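{- Let $G$ be a connected simple graph and let $v\in V(G)$ be a vertex that is not a cut vertex of $G$. Then $$\chi_{dom}(G)-1\leq \chi_{dom}(G-v)\leq \chi_{dom}(G)+\deg v-1.$$
   Context: A dominated coloring of a simple graph $H$ is a proper vertex coloring of $H$ such that every color class is dominated by at least one vertex, i.e. for each color class $C$ there is a vertex $x$ of $H$ adjacent to every vertex of $C$. The dominated chromatic number $\chi_{dom}(H)$ is the minimum number of colors in a dominated coloring of $H$. $G-v$ denotes the graph obtained from $G$ by deleting $v$ and all edges incident with $v$. -}

module Defs where

open import Data.Nat using (ℕ; suc)
open import Data.Fin using (Fin; punchIn)
open import Data.Bool using (Bool; true; false; T)
open import Data.Product using (Σ; ∃; _×_)
open import Data.List using (List; filter; length)
open import Data.List using (allFin)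
open import Relation.Nullary using (¬_)
open import Relation.Binary.PropositionalEquality using (_≡_; _≢_)
open import Relation.Binary.Construct.Closure.ReflexiveTransitive using (Star)
open import Function using (Surjective)

record Graph (n : ℕ) : Set where
  field
    adj     : Fin n → Fin n → Bool
    sym     : ∀ x y → adj x y ≡ adj y x
    irrefl  : ∀ x → adj x x ≡ false
open Graph public

Adj : ∀ {n} → Graph n → Fin n → Fin n → Set
Adj G x y = T (adj G x y)

-- G - v : delete vertex v; vertices of G - v are Fin n, embedded via punchIn v.
delete : ∀ {n} → Graph (suc n) → Fin (suc n) → Graph n
delete G v = record
  { adj    = λ x y → adj G (punchIn v x) (punchIn v y)
  ; sym    = λ x y → sym G (punchIn v x) (punchIn v y)
  ; irrefl = λ x → irrefl G (punchIn v x)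
  }

deg : ∀ {n} → Graph n → Fin n → ℕ
deg {n} G v = length (filter (λ y → Data.Bool._≟_ (adj G v y) true) (allFin n))

Reach : ∀ {n} → Graph n → Fin n → Fin n → Set
Reach G = Star (Adj G)

Connected : ∀ {n} → Graph n → Set
Connected {n} G = ∀ (x y : Fin n) → Reach G x y

-- v is a cut vertex: deleting it increases the number of components, i.e.
-- some two vertices other than v lie in one component of G but not of G - v.
CutVertex : ∀ {n} → Graph (suc n) → Fin (suc n) → Set
CutVertex {n} G v = Σ (Fin n) λ x → Σ (Fin n) λ y →
  Reach G (punchIn v x) (punchIn v y) × ¬ Reach (delete G v) x y

Proper : ∀ {n k} → Graph n → (Fin n → Fin k) → Set
Proper G c = ∀ x y → Adj G x y → c x ≢ c y

-- a dominated colouring using exactly k colours (every colour is used):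
-- proper, and each colour class C has a vertex x adjacent to all of C
DominatedColoring : ∀ {n} → Graph n → (k : ℕ) → (Fin n → Fin k) → Set
DominatedColoring {n} G k c =
  Proper G c × Surjective _≡_ _≡_ c ×
  (∀ (i : Fin k) → Σ (Fin n) λ x → ∀ (y : Fin n) → c y ≡ i → Adj G x y)

HasDomColoring : ∀ {n} → Graph n → ℕ → Set
HasDomColoring {n} G k = Σ (Fin n → Fin k) (DominatedColoring G k)

IsChiDom : ∀ {n} → Graph n → ℕ → Set
IsChiDom G k = HasDomColoring G k × (∀ m → HasDomColoring G m → k Data.Nat.≤ m)

module Submission where

-- Lower bound: a dominated k′-colouring of G - v with v put into a fresh
-- colour class {v} is a dominated colouring of G, because v has a neighbour
-- (the dominator of its own class in any dominated colouring of G).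
--
-- Upper bound: let c be a dominated k-colouring of G.  In G - v a class of
-- c loses its dominator only if the dominator was v; all vertices of such a
-- class are neighbours of v, so each of them receives a private colour,
-- indexed by its position among the deg v neighbours of v.  Private
-- singleton classes are dominated by any neighbour in G - v.
--
-- Both constructions yield colourings in which some colours may be unused,
-- so the file first shows that unused colours can be discarded: a
-- "weakly dominated" m-colouring gives χ_dom ≤ m, and χ_dom < m if some
-- colour is unused.

open import Defs
open import Data.Nat using (ℕ; suc; zero; _+_; _≤_; s≤s; z≤n)
open import Data.Nat.Properties using (≤-trans; ≤-refl; m≤n⇒m≤1+n)
open import Data.Fin using (Fin; punchIn; punchOut; fromℕ; inject₁; splitAt; _↑ˡ_; _↑ʳ_; _≟_)
open import Data.Fin.Properties
  using ( punchIn-punchOut; punchOut-punchIn; punchInᵢ≢i; punchOut-injective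
        ; punchIn-injective; punchOut-cong; fromℕ≢inject₁; inject₁-injective
        ; ↑ˡ-injective; ↑ʳ-injective; splitAt-↑ˡ; splitAt-↑ʳ; any? )
open import Data.Product using (Σ; _×_; _,_; proj₁; proj₂)
open import Data.Bool using (T)
import Data.Bool as Bool
open import Data.Bool.Properties using (T-≡)
import Data.List.Relation.Unary.Any as Any
open import Data.List.Membership.Propositional.Properties using (∈-filter⁺; ∈-allFin)
open import Data.List.Membership.Setoid.Properties using (index-injective)
open import Data.Empty using (⊥-elim)
open import Function using (_∘_; Equivalence; Surjective)
open import Relation.Nullary using (¬_; Dec; yes; no)
open import Relation.Nullary.Decidable using (¬?)
open import Relation.Binary.PropositionalEquality as ≡
  using (_≡_; _≢_; refl; trans; cong; subst; setoid)

↑ˡ≢↑ʳ : ∀ {k d} (i : Fin k) (j : Fin d) → i ↑ˡ d ≢ k ↑ʳ j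
↑ˡ≢↑ʳ {k} {d} i j e
  with trans (≡.sym (splitAt-↑ˡ k i d)) (trans (cong (splitAt k) e) (splitAt-↑ʳ k d j))
... | ()

data DeletionView {n} (v : Fin (suc n)) : Fin (suc n) → Set where
  deleted  : DeletionView v v
  survivor : (z : Fin n) → DeletionView v (punchIn v z)

deletionView : ∀ {n} (v y : Fin (suc n)) → DeletionView v y
deletionView v y with v ≟ y
... | yes refl = deleted
... | no v≢y   = subst (DeletionView v) (punchIn-punchOut v≢y) (survivor (punchOut v≢y))

adj-sym : ∀ {n} (G : Graph n) {x y} → Adj G x y → Adj G y x
adj-sym G {x} {y} = subst T (sym G x y)

adj⇒≢ : ∀ {n} (G : Graph n) {x y} → Adj G x y → x ≢ y
adj⇒≢ G {x} a refl = subst T (irrefl G x) a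

survivingNeighbour : ∀ {n} (G : Graph (suc n)) (v u : Fin (suc n)) → Adj G u v →
  Σ (Fin n) λ z → Adj G v (punchIn v z)
survivingNeighbour G v u uv with deletionView v u
... | deleted    = ⊥-elim (adj⇒≢ G uv refl)
... | survivor z = z , adj-sym G uv

-- The neighbours of v are numbered injectively by Fin (deg G v): a neighbour
-- is sent to its position in the list of neighbours counted by deg.
module _ {n} (G : Graph n) (v : Fin n) where

  nbrIndex : ∀ y → Adj G v y → Fin (deg G v)
  nbrIndex y a =
    Any.index (∈-filter⁺ (λ x → adj G v x Bool.≟ Bool.true) (∈-allFin y) (Equivalence.to T-≡ a))

  nbrIndex-injective : ∀ {y y′} (a : Adj G v y) (a′ : Adj G v y′) →
    nbrIndex y a ≡ nbrIndex y′ a′ → y ≡ y′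
  nbrIndex-injective _ _ = index-injective (setoid (Fin n)) _ _

module _ {n} (G : Graph n) {k} {c : Fin n → Fin k} (dc : DominatedColoring G k c) where

  dominator : Fin k → Fin n
  dominator i = proj₁ (proj₂ (proj₂ dc) i)

  dominates : ∀ i y → c y ≡ i → Adj G (dominator i) y
  dominates i = proj₂ (proj₂ (proj₂ dc) i)

  neighbourOf : ∀ y → Σ (Fin n) λ x → Adj G x y
  neighbourOf y = dominator (c y) , dominates (c y) y refl

WeaklyDominated : ∀ {n} → Graph n → (m : ℕ) → (Fin n → Fin m) → Set
WeaklyDominated {n} G m c = Proper G c ×
  (∀ i → (Σ (Fin n) λ y → c y ≡ i) → Σ (Fin n) λ x → ∀ y → c y ≡ i → Adj G x y)

dropColour : ∀ {n m} (G : Graph n) (c : Fin n → Fin (suc m)) → WeaklyDominated G (suc m) c →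
  (i : Fin (suc m)) → (∀ y → c y ≢ i) → Σ (Fin n → Fin m) (WeaklyDominated G m)
dropColour {n} {m} G c (proper , dominated) i unused = c′ , proper′ , dominated′
  where
  i≢c : ∀ y → i ≢ c y
  i≢c y = unused y ∘ ≡.sym

  c′ : Fin n → Fin m
  c′ y = punchOut (i≢c y)

  restore : ∀ y j → c′ y ≡ j → c y ≡ punchIn i j
  restore y j e = trans (≡.sym (punchIn-punchOut (i≢c y))) (cong (punchIn i) e)

  proper′ : Proper G c′
  proper′ x y a = proper x y a ∘ punchOut-injective (i≢c x) (i≢c y)

  dominated′ : ∀ j → (Σ (Fin n) λ y → c′ y ≡ j) →
    Σ (Fin n) λ x → ∀ y → c′ y ≡ j → Adj G x y
  dominated′ j (y , e) with dominated (punchIn i j) (y , restore y j e)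
  ... | x , dom = x , λ w e′ → dom w (restore w j e′)

shrink : ∀ {n} (G : Graph n) m (c : Fin n → Fin m) → WeaklyDominated G m c →
  Σ ℕ λ k → k ≤ m × HasDomColoring G k
shrink G zero    c (proper , _) = zero , z≤n , c , proper , (λ ()) , (λ ())
shrink {n} G (suc m) c w with any? (λ i → ¬? (any? (λ y → c y ≟ i)))
... | yes (i , unused) with dropColour G c w i (λ y e → unused (y , e))
...   | c′ , w′ with shrink G m c′ w′
...     | k , k≤m , h = k , m≤n⇒m≤1+n k≤m , h
shrink {n} G (suc m) c w | no allUsed = suc m , ≤-refl , c , proj₁ w , surjective , dominated
  where
  used : ∀ i → Σ (Fin n) λ y → c y ≡ i
  used i with any? (λ y → c y ≟ i)
  ... | yes p = p
  ... | no ¬p = ⊥-elim (allUsed (i , ¬p))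

  surjective : Surjective _≡_ _≡_ c
  surjective i = proj₁ (used i) , λ { refl → proj₂ (used i) }

  dominated : ∀ i → Σ (Fin n) λ x → ∀ y → c y ≡ i → Adj G x y
  dominated i = proj₂ w i (used i)

chiDom-≤ : ∀ {n} (G : Graph n) {k m} {c : Fin n → Fin m} →
  IsChiDom G k → WeaklyDominated G m c → k ≤ m
chiDom-≤ G {m = m} {c} (_ , minimal) w with shrink G m c w
... | k₀ , k₀≤m , h = ≤-trans (minimal k₀ h) k₀≤m

chiDom-< : ∀ {n} (G : Graph n) {k m} {c : Fin n → Fin m} →
  IsChiDom G k → WeaklyDominated G m c → (Σ (Fin m) λ i → ∀ y → c y ≢ i) → suc k ≤ m
chiDom-< G {m = suc m} {c} χ w (i , unused) with dropColour G c w i unused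
... | c′ , w′ = s≤s (chiDom-≤ G χ w′)

module FreshColour {n} (G : Graph (suc n)) (v : Fin (suc n))
  {k′} {c′ : Fin n → Fin k′} (dc′ : DominatedColoring (delete G v) k′ c′)
  (u : Fin (suc n)) (uv : Adj G u v) where

  colour : Fin (suc n) → Fin (suc k′)
  colour y with v ≟ y
  ... | yes _   = fromℕ k′
  ... | no v≢y = inject₁ (c′ (punchOut v≢y))

  colour-deleted : colour v ≡ fromℕ k′
  colour-deleted with v ≟ v
  ... | yes _   = refl
  ... | no v≢v = ⊥-elim (v≢v refl)

  colour-survivor : ∀ z → colour (punchIn v z) ≡ inject₁ (c′ z)
  colour-survivor z with v ≟ punchIn v z
  ... | yes v≡z = ⊥-elim (punchInᵢ≢i v z (≡.sym v≡z))
  ... | no _    = cong (inject₁ ∘ c′) (trans (punchOut-cong v refl) (punchOut-punchIn v))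

  fresh≢old : ∀ z → colour v ≢ colour (punchIn v z)
  fresh≢old z e = fromℕ≢inject₁ (trans (≡.sym colour-deleted) (trans e (colour-survivor z)))

  old-injective : ∀ z w → colour (punchIn v z) ≡ colour (punchIn v w) → c′ z ≡ c′ w
  old-injective z w e =
    inject₁-injective (trans (≡.sym (colour-survivor z)) (trans e (colour-survivor w)))

  proper : Proper G colour
  proper x y a with deletionView v x | deletionView v y
  ... | deleted    | deleted    = ⊥-elim (adj⇒≢ G a refl)
  ... | deleted    | survivor z = fresh≢old z
  ... | survivor z | deleted    = fresh≢old z ∘ ≡.sym
  ... | survivor z | survivor w = proj₁ dc′ z w a ∘ old-injective z w

  dominated : ∀ i → (Σ (Fin (suc n)) λ y → colour y ≡ i) →
    Σ (Fin (suc n)) λ x → ∀ y → colour y ≡ i → Adj G x y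
  dominated _ (y , refl) with deletionView v y
  ... | deleted = u , dominatedByU
    where
    dominatedByU : ∀ w → colour w ≡ colour v → Adj G u w
    dominatedByU w e with deletionView v w
    ... | deleted    = uv
    ... | survivor z = ⊥-elim (fresh≢old z (≡.sym e))
  ... | survivor z = punchIn v (dominator (delete G v) dc′ (c′ z)) , dominatedByOld
    where
    dominatedByOld : ∀ w → colour w ≡ colour (punchIn v z) →
      Adj G (punchIn v (dominator (delete G v) dc′ (c′ z))) w
    dominatedByOld w e with deletionView v w
    ... | deleted    = ⊥-elim (fresh≢old z e)
    ... | survivor x = dominates (delete G v) dc′ (c′ z) x (old-injective x z e)

  weaklyDominated : WeaklyDominated G (suc k′) colour
  weaklyDominated = proper , dominated

-- Upper bound: a vertex of G - v whose class in c was dominated by v is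
-- "orphaned"; it is a neighbour of v and gets the private colour
-- k + nbrIndex.
module Orphans {n} (G : Graph (suc n)) (v : Fin (suc n))
  {k} {c : Fin (suc n) → Fin k} (dc : DominatedColoring G k c)
  (hasNbr : ∀ z → Σ (Fin n) λ x → Adj (delete G v) x z) where

  Orphan : Fin n → Set
  Orphan z = dominator G dc (c (punchIn v z)) ≡ v

  orphan? : ∀ z → Dec (Orphan z)
  orphan? z = dominator G dc (c (punchIn v z)) ≟ v

  orphan-adj : ∀ {z} → Orphan z → Adj G v (punchIn v z)
  orphan-adj {z} o = subst (λ x → Adj G x (punchIn v z)) o (dominates G dc _ (punchIn v z) refl)

  recolour : ∀ z → Dec (Orphan z) → Fin (k + deg G v)
  recolour z (yes o) = k ↑ʳ nbrIndex G v (punchIn v z) (orphan-adj o)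
  recolour z (no _)  = c (punchIn v z) ↑ˡ deg G v

  colour : Fin n → Fin (k + deg G v)
  colour z = recolour z (orphan? z)

  orphan-injective : ∀ {y w} (oy : Orphan y) (ow : Orphan w) →
    recolour y (yes oy) ≡ recolour w (yes ow) → y ≡ w
  orphan-injective oy ow =
    punchIn-injective v _ _ ∘ nbrIndex-injective G v _ _ ∘ ↑ʳ-injective k _ _

  kept-injective : ∀ {y w} (¬oy : ¬ Orphan y) (¬ow : ¬ Orphan w) →
    recolour y (no ¬oy) ≡ recolour w (no ¬ow) → c (punchIn v y) ≡ c (punchIn v w)
  kept-injective _ _ = ↑ˡ-injective (deg G v) _ _

  kept≢orphan : ∀ {y w} (¬oy : ¬ Orphan y) (ow : Orphan w) → recolour y (no ¬oy) ≢ recolour w (yes ow)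
  kept≢orphan _ _ = ↑ˡ≢↑ʳ _ _

  proper : Proper (delete G v) colour
  proper x y a = distinct (orphan? x) (orphan? y)
    where
    distinct : (ox : Dec (Orphan x)) (oy : Dec (Orphan y)) → recolour x ox ≢ recolour y oy
    distinct (yes ox) (yes oy) = adj⇒≢ (delete G v) a ∘ orphan-injective ox oy
    distinct (yes ox) (no ¬oy) = kept≢orphan ¬oy ox ∘ ≡.sym
    distinct (no ¬ox) (yes oy) = kept≢orphan ¬ox oy
    distinct (no ¬ox) (no ¬oy) = proj₁ dc _ _ a ∘ kept-injective ¬ox ¬oy

  -- A private class is dominated by any neighbour in G - v; a kept class by
  -- its old dominator, which is not v.
  classDominator : ∀ y (oy : Dec (Orphan y)) → Σ (Fin n) λ x →
    ∀ w (ow : Dec (Orphan w)) → recolour w ow ≡ recolour y oy → Adj (delete G v) x w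
  classDominator y (yes oy) = proj₁ (hasNbr y) , dom
    where
    dom : ∀ w (ow : Dec (Orphan w)) → recolour w ow ≡ recolour y (yes oy) →
      Adj (delete G v) (proj₁ (hasNbr y)) w
    dom w (yes ow) e = subst (Adj (delete G v) _) (orphan-injective oy ow (≡.sym e)) (proj₂ (hasNbr y))
    dom w (no ¬ow) e = ⊥-elim (kept≢orphan ¬ow oy e)
  classDominator y (no ¬oy) = punchOut v≢d , dom
    where
    v≢d : v ≢ dominator G dc (c (punchIn v y))
    v≢d = ¬oy ∘ ≡.sym

    dom : ∀ w (ow : Dec (Orphan w)) → recolour w ow ≡ recolour y (no ¬oy) →
      Adj (delete G v) (punchOut v≢d) w
    dom w (yes ow) e = ⊥-elim (kept≢orphan ¬oy ow (≡.sym e))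
    dom w (no ¬ow) e = subst (λ x → Adj G x (punchIn v w)) (≡.sym (punchIn-punchOut v≢d))
      (dominates G dc _ (punchIn v w) (kept-injective ¬ow ¬oy e))

  dominated : ∀ i → (Σ (Fin n) λ y → colour y ≡ i) →
    Σ (Fin n) λ x → ∀ w → colour w ≡ i → Adj (delete G v) x w
  dominated _ (y , refl) with classDominator y (orphan? y)
  ... | x , dom = x , λ w e → dom w (orphan? w) e

  weaklyDominated : WeaklyDominated (delete G v) (k + deg G v) colour
  weaklyDominated = proper , dominated

  -- Take a neighbour u of v in G - v: if u is an
  -- orphan, its old colour c u has become unused (each vertex of that class
  -- is an orphan); otherwise u's private colour is unused.
  unusedColour : ∀ (u : Fin n) → Adj G v (punchIn v u) →
    Σ (Fin (k + deg G v)) λ i → ∀ z → colour z ≢ i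
  unusedColour u vu with orphan? u
  ... | yes ou = c (punchIn v u) ↑ˡ deg G v , λ z → unused z (orphan? z)
    where
    unused : ∀ z (oz : Dec (Orphan z)) → recolour z oz ≢ c (punchIn v u) ↑ˡ deg G v
    unused z (yes oz) = ↑ˡ≢↑ʳ _ _ ∘ ≡.sym
    unused z (no ¬oz) e = ¬oz (trans (cong (dominator G dc) (↑ˡ-injective (deg G v) _ _ e)) ou)
  ... | no ¬ou = k ↑ʳ nbrIndex G v (punchIn v u) vu , λ z → unused z (orphan? z)
    where
    unused : ∀ z (oz : Dec (Orphan z)) → recolour z oz ≢ k ↑ʳ nbrIndex G v (punchIn v u) vu
    unused z (yes oz) e = ¬ou (subst Orphan z≡u oz)
      where
      z≡u : z ≡ u
      z≡u = punchIn-injective v _ _ (nbrIndex-injective G v _ _ (↑ʳ-injective k _ _ e))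
    unused z (no ¬oz) = ↑ˡ≢↑ʳ _ _

mainTheorem2 : ∀ {n : ℕ} (G : Graph (suc n)) (v : Fin (suc n)) →
    Connected G → ¬ CutVertex G v →
    ∀ (k k′ : ℕ) → IsChiDom G k → IsChiDom (delete G v) k′ →
    (k ≤ suc k′) × (suc k′ ≤ k + deg G v)
mainTheorem2 G v _ _ k k′ χG@((_ , dc) , _) χG-v@((_ , dc′) , _) = lower , upper
  where
  u : Fin _
  u = proj₁ (neighbourOf G dc v)

  uv : Adj G u v
  uv = proj₂ (neighbourOf G dc v)

  lower : k ≤ suc k′
  lower = chiDom-≤ G χG (FreshColour.weaklyDominated G v dc′ u uv)

  upper : suc k′ ≤ k + deg G v
  upper with survivingNeighbour G v u uv
  ... | z , vz = chiDom-< (delete G v) χG-v (Orphans.weaklyDominated G v dc hasNbr)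
                   (Orphans.unusedColour G v dc hasNbr z vz)
    where
    hasNbr : ∀ y → Σ (Fin _) λ x → Adj (delete G v) x y
    hasNbr = neighbourOf (delete G v) dc′
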